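{- Let $\phi := \Pi.\psi$ be a QBF in prenex CNF with prefix $\Pi := Q_1B_1\ldots Q_nB_n$ and let $0 \le i \le n$. For all trees $T$ and $T^A$: if $T$ is a model of $\phi$ and $T^A$ is a rooted subtree of $T$ that is a pre-model of $\mathit{Abs}(\phi,i)$, then $T^A$ is a model of $\mathit{Abs}(\phi,i)$.
   Context: A QBF in prenex CNF is $\Pi.\psi$ with $\Pi = Q_1B_1\ldots Q_nB_n$ (pairwise disjoint variable blocks, $Q_i\in\{\forall,\exists\}$, $Q_i\ne Q_{i+1}$, $Q_n=\exists$) and CNF $\psi$ over exactly the variables of $\Pi$. The order $\le_\Pi$ orders variables by block index, refined by a fixed total order inside each block. Abstraction: $\mathit{Abs}(\Pi,0):=\Pi$; for $1\le i\le n$, $\mathit{Abs}(\Pi,i) := \exists(B_1\cup\dots\cup B_i)\,Q_{i+1}B_{i+1}\ldots Q_nB_n$ (adjacent blocks with the same quantifier merged), keeping the same total order of variables; $\mathit{Abs}(\phi,i) := \mathit{Abs}(\Pi,i).\psi$. Thus $\phi$ and $\mathit{Abs}(\phi,i)$ have the same assignment tree, differing only in which variables are universal. Tree semantics: the assignment tree has internal nodes associated with variables in the order $\le_\Pi$, each with two children (edges labelled $\bar x$, $x$); root-to-leaf paths are complete assignments; a leaf is labelled $\top$ iff its assignment satisfies $\psi$; an existential (universal) internal node is labelled $\top$ iff one (both) children are. A pre-model (w.r.t. a given prefix) is a subtree containing the root such that every universal internal node in it has both children in it and every existential internal node exactly one. A model is a pre-model all of whose nodes are labelled $\top$. A rooted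 subtree $T''\subseteq T'$ has the same root as $T'$ and its leaves are a subset of the leaves of $T'$. -}

module Defs where

open import Data.Nat using (ℕ; zero; suc; _+_; _<_; _≤_)
open import Data.Bool using (Bool; true; false; _∧_; _∨_; not; if_then_else_)
open import Data.List using (List; []; _∷_; _++_; [_]; length; take; drop; replicate; concatMap; map)
open import Data.Nat.ListAction using (sum)
open import Data.Bool.ListAction using (all; any)
open import Data.List.Relation.Unary.All using (All)
open import Data.List.Relation.Unary.Linked using (Linked)
open import Data.Maybe using (Maybe; just; nothing)
open import Data.Product using (_×_; _,_; proj₁; proj₂)
open import Data.Unit using (⊤)
open import Data.Empty using (⊥)
open import Relation.Binary.PropositionalEquality using (_≡_; _≢_)

-- Convention: the variables of a prefix are identified with their
-- positions 0,1,…,m-1 in the total order ≤_Π (m = number of variables).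
-- A prefix Q₁B₁…QₙBₙ is the list of blocks (Qᵢ , |Bᵢ|); block Bᵢ consists
-- of the next |Bᵢ| variables in the order.

data Q : Set where
  ∀q ∃q : Q

Prefix : Set
Prefix = List (Q × ℕ)

size : Prefix → ℕ
size Π = sum (map proj₂ Π)

expand : Prefix → List Q
expand = concatMap (λ b → replicate (proj₂ b) (proj₁ b))

lastQ : Prefix → Maybe Q
lastQ [] = nothing
lastQ (b ∷ []) = just (proj₁ b)
lastQ (b ∷ c ∷ bs) = lastQ (c ∷ bs)

record WFPrefix (Π : Prefix) : Set where
  field
    blocksNonempty : All (λ b → 0 < proj₂ b) Π
    alternating    : Linked (λ b c → proj₁ b ≢ proj₁ c) Π
    lastExists     : lastQ Π ≡ just ∃q

Literal : Set
Literal = ℕ × Bool      -- (x , true) is x, (x , false) is x̄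

Clause : Set
Clause = List Literal

CNF : Set
CNF = List Clause

CNFOver : ℕ → CNF → Set
CNFOver m ψ = All (All (λ l → proj₁ l < m)) ψ

-- (partial) assignments: values of the first variables in order
Assignment : Set
Assignment = List Bool

nth : Assignment → ℕ → Maybe Bool
nth [] _ = nothing
nth (b ∷ ρ) zero = just b
nth (b ∷ ρ) (suc k) = nth ρ k

litVal : Assignment → Literal → Bool
litVal ρ (x , s) with nth ρ x
... | nothing = false
... | just c = if s then c else not c

sat : CNF → Assignment → Bool
sat ψ ρ = all (any (litVal ρ)) ψ

consMerge : Q × ℕ → Prefix → Prefix
consMerge (∃q , s) ((∃q , k) ∷ r) = (∃q , s + k) ∷ r
consMerge b r = b ∷ r

Abs : Prefix → ℕ → Prefix
Abs Π zero = Π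
Abs Π (suc i) = consMerge (∃q , size (take (suc i) Π)) (drop (suc i) Π)

-- label qs ψ ρ : the label of the node of the assignment tree reached by
-- the partial assignment ρ, where qs are the quantifiers of the remaining
-- (not yet assigned) variables. Left child = edge x̄ (false), right = x.

label : List Q → CNF → Assignment → Bool
label [] ψ ρ = sat ψ ρ
label (∃q ∷ qs) ψ ρ = label qs ψ (ρ ++ [ false ]) ∨ label qs ψ (ρ ++ [ true ])
label (∀q ∷ qs) ψ ρ = label qs ψ (ρ ++ [ false ]) ∧ label qs ψ (ρ ++ [ true ])

-- Subtrees (containing the root) of the assignment tree: each node keeps
-- a possibly absent left (x̄) and right (x) child.
data Tree : Set where
  leaf : Tree
  node : Maybe Tree → Maybe Tree → Tree

PreModel : List Q → Tree → Set
PreModel [] leaf = ⊤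
PreModel [] (node _ _) = ⊥
PreModel (q ∷ qs) leaf = ⊥
PreModel (∀q ∷ qs) (node (just l) (just r)) = PreModel qs l × PreModel qs r
PreModel (∀q ∷ qs) (node _ _) = ⊥
PreModel (∃q ∷ qs) (node (just l) nothing) = PreModel qs l
PreModel (∃q ∷ qs) (node nothing (just r)) = PreModel qs r
PreModel (∃q ∷ qs) (node _ _) = ⊥

AllTop : List Q → CNF → Assignment → Tree → Set
AllTopM : List Q → CNF → Assignment → Maybe Tree → Set
AllTop qs ψ ρ leaf = label qs ψ ρ ≡ true
AllTop [] ψ ρ (node _ _) = ⊥
AllTop (q ∷ qs) ψ ρ (node l r) =
  label (q ∷ qs) ψ ρ ≡ true
  × AllTopM qs ψ (ρ ++ [ false ]) l
  × AllTopM qs ψ (ρ ++ [ true ]) r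
AllTopM qs ψ ρ nothing = ⊤
AllTopM qs ψ ρ (just t) = AllTop qs ψ ρ t

Model : List Q → CNF → Tree → Set
Model qs ψ T = PreModel qs T × AllTop qs ψ [] T

-- Rooted subtrees: T'' ⊑ T' iff same root, T'' ⊆ T', and every leaf of
-- T'' is a leaf of T'.

NoChildren : Maybe Tree → Maybe Tree → Set
NoChildren l r = (l ≡ nothing) × (r ≡ nothing)

data _⊑_ : Tree → Tree → Set
data _⊑M_ : Maybe Tree → Maybe Tree → Set

data _⊑_ where
  leaf⊑ : leaf ⊑ leaf
  node⊑ : ∀ {l r l' r'} → l ⊑M l' → r ⊑M r' →
          (NoChildren l r → NoChildren l' r') → node l r ⊑ node l' r'

data _⊑M_ where
  nothing⊑ : ∀ {m} → nothing ⊑M m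
  just⊑ : ∀ {s t} → s ⊑ t → just s ⊑M just t

RootedSubtree : Tree → Tree → Set
RootedSubtree T'' T' = T'' ⊑ T'

module Submission where

-- The leaves of T^A are leaves of the model T, so their assignments satisfy ψ.
-- In a pre-model whose leaves satisfy ψ every node is labelled ⊤, bottom-up:
-- a universal node keeps both children and an existential node one of them.
-- Neither step looks at which variables are universal, so the quantifier
-- lists of T and T^A are arbitrary; the hypotheses on Π, ψ and i are unused.

open import Defs
open import Data.Nat using (ℕ; _≤_)
open import Data.List using ([]; _∷_; length; _++_; [_])
open import Data.Bool using (true; false)
open import Data.Bool.Properties using (∨-zeroʳ)
open import Data.Maybe using (Maybe; just; nothing)
open import Data.Product using (_×_; _,_)
open import Data.Unit using (⊤; tt)
open import Relation.Binary.PropositionalEquality using (_≡_; refl)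

LeavesSat : CNF → Assignment → Tree → Set
LeavesSatM : CNF → Assignment → Maybe Tree → Set
LeavesSat ψ ρ leaf = sat ψ ρ ≡ true
LeavesSat ψ ρ (node l r) = LeavesSatM ψ (ρ ++ [ false ]) l × LeavesSatM ψ (ρ ++ [ true ]) r
LeavesSatM ψ ρ nothing = ⊤
LeavesSatM ψ ρ (just t) = LeavesSat ψ ρ t

AllTop⇒label : ∀ qs ψ ρ t → AllTop qs ψ ρ t → label qs ψ ρ ≡ true
AllTop⇒label qs       ψ ρ leaf       top       = top
AllTop⇒label (q ∷ qs) ψ ρ (node l r) (top , _) = top

model⇒leavesSat : ∀ qs ψ ρ t → PreModel qs t → AllTop qs ψ ρ t → LeavesSat ψ ρ t
model⇒leavesSat []        ψ ρ leaf                  _         top = top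
model⇒leavesSat (∀q ∷ qs) ψ ρ (node (just l) (just r)) (pl , pr) (_ , tl , tr) =
  model⇒leavesSat qs ψ _ l pl tl , model⇒leavesSat qs ψ _ r pr tr
model⇒leavesSat (∃q ∷ qs) ψ ρ (node (just l) nothing)  pl        (_ , tl , _) =
  model⇒leavesSat qs ψ _ l pl tl , tt
model⇒leavesSat (∃q ∷ qs) ψ ρ (node nothing (just r))  pr        (_ , _ , tr) =
  tt , model⇒leavesSat qs ψ _ r pr tr

⊑-leavesSat : ∀ {ψ ρ s t} → s ⊑ t → LeavesSat ψ ρ t → LeavesSat ψ ρ s
⊑M-leavesSat : ∀ {ψ ρ s t} → s ⊑M t → LeavesSatM ψ ρ t → LeavesSatM ψ ρ s
⊑-leavesSat leaf⊑             sat-t          = sat-t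
⊑-leavesSat (node⊑ sl sr _) (sat-l , sat-r) = ⊑M-leavesSat sl sat-l , ⊑M-leavesSat sr sat-r
⊑M-leavesSat nothing⊑  _     = tt
⊑M-leavesSat (just⊑ s) sat-t = ⊑-leavesSat s sat-t

leavesSat⇒allTop : ∀ qs ψ ρ t → PreModel qs t → LeavesSat ψ ρ t → AllTop qs ψ ρ t
leavesSat⇒allTop []        ψ ρ leaf                     _         sat-t = sat-t
leavesSat⇒allTop (∀q ∷ qs) ψ ρ (node (just l) (just r)) (pl , pr) (sl , sr)
  with tl ← leavesSat⇒allTop qs ψ _ l pl sl | tr ← leavesSat⇒allTop qs ψ _ r pr sr
  rewrite AllTop⇒label qs ψ _ l tl | AllTop⇒label qs ψ _ r tr = refl , tl , tr
leavesSat⇒allTop (∃q ∷ qs) ψ ρ (node (just l) nothing)  pl        (sl , _)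
  with tl ← leavesSat⇒allTop qs ψ _ l pl sl
  rewrite AllTop⇒label qs ψ _ l tl = refl , tl , tt
leavesSat⇒allTop (∃q ∷ qs) ψ ρ (node nothing (just r))  pr        (_ , sr)
  with tr ← leavesSat⇒allTop qs ψ _ r pr sr
  rewrite AllTop⇒label qs ψ _ r tr = ∨-zeroʳ _ , tt , tr

proposition3 : (Π : Prefix) (ψ : CNF) → WFPrefix Π → CNFOver (size Π) ψ →
    (i : ℕ) → i ≤ length Π → (T TA : Tree) →
    Model (expand Π) ψ T →
    RootedSubtree TA T →
    PreModel (expand (Abs Π i)) TA →
    Model (expand (Abs Π i)) ψ TA
proposition3 Π ψ _ _ i _ T TA (preT , topT) TA⊑T preTA =
  preTA , leavesSat⇒allTop (expand (Abs Π i)) ψ [] TA preTA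
            (⊑-leavesSat TA⊑T (model⇒leavesSat (expand Π) ψ [] T preT topT))
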